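{- Let $(A,\wedge,\vee,\cdot,\rightarrow,e)$ be an algebra of type $(2,2,2,2,0)$. Then $(A,\wedge,\vee,\cdot,\rightarrow,e)$ is an srl-monoid if and only if $(A,\wedge,\vee,\cdot,e)$ is a commutative l-monoid and the following identities are satisfied: 1) $e\leq (x\wedge y)\rightarrow y$; 2) $x\rightarrow y \leq (z\wedge e)\rightarrow (x\rightarrow y)$; 3) $x\cdot (x\rightarrow y) \leq y$; 4) $z\rightarrow (x\wedge y) = (z\rightarrow x)\wedge (z\rightarrow y)$; 5) $e\rightarrow ((e\rightarrow x)\cdot(e\rightarrow y)) = (e\rightarrow x)\cdot (e\rightarrow y)$; 6) $e\rightarrow y \leq x \rightarrow (x\cdot (e\rightarrow y))$. Here $\leq$ is the lattice order of $(A,\wedge,\vee)$.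
   Context: A commutative l-monoid is an algebra $(A,\wedge,\vee,\cdot,e)$ of type $(2,2,2,0)$ such that $(A,\wedge,\vee)$ is a lattice, $(A,\cdot,e)$ is a commutative monoid and $(a\vee b)\cdot c=(a\cdot c)\vee(b\cdot c)$ for all $a,b,c\in A$. An algebra $(A,\wedge,\vee,\cdot,\rightarrow,e)$ of type $(2,2,2,2,0)$ is an srl-monoid (subresiduated lattice ordered commutative monoid) if $(A,\wedge,\vee,\cdot,e)$ is a commutative l-monoid and there is a subalgebra $Q$ of $(A,\wedge,\vee,\cdot,e)$ such that for all $a,b\in A$ the set $\{q\in Q: a\cdot q\leq b\}$ has a maximum and $a\rightarrow b$ equals this maximum (equivalently: $a\rightarrow b\in Q$ and for all $q\in Q$, $a\cdot q\le b$ iff $q\le a\rightarrow b$). In that case $Q=\{a\in A: e\rightarrow a=a\}$. -}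

module Defs where

open import Level using (Level; suc)
open import Relation.Binary.PropositionalEquality using (_≡_)
open import Algebra.Core using (Op₂)
open import Algebra.Structures using (IsCommutativeMonoid)
open import Algebra.Lattice.Structures using (IsLattice)
open import Algebra.Definitions using (_DistributesOverʳ_)
open import Data.Product using (Σ; _×_)
open import Function.Bundles using (_⇔_)

record Algebra22220 (a : Level) : Set (suc a) where
  field
    Carrier : Set a
    _∧_ _∨_ _·_ _⇒_ : Op₂ Carrier
    e : Carrier

  infixr 6 _∨_
  infixr 7 _∧_
  infixl 8 _·_
  infixr 5 _⇒_

  _≤_ : Carrier → Carrier → Set a
  x ≤ y = (x ∧ y) ≡ x

  record IsCommLMonoid : Set a where
    field
      isLattice : IsLattice _≡_ _∨_ _∧_
      isCommutativeMonoid : IsCommutativeMonoid _≡_ _·_ e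
      ·-distribʳ-∨ : _DistributesOverʳ_ _≡_ _·_ _∨_

  record IsSubalgebra (Q : Carrier → Set a) : Set a where
    field
      ∧-closed : ∀ {x y} → Q x → Q y → Q (x ∧ y)
      ∨-closed : ∀ {x y} → Q x → Q y → Q (x ∨ y)
      ·-closed : ∀ {x y} → Q x → Q y → Q (x · y)
      e-closed : Q e

  -- srl-monoid: commutative l-monoid, and a subalgebra Q such that
  -- a ⇒ b is the maximum of { q ∈ Q : a · q ≤ b }.
  record IsSrlMonoid : Set (suc a) where
    field
      isCommLMonoid : IsCommLMonoid
      Q : Carrier → Set a
      isSubalgebra : IsSubalgebra Q
      ⇒-in-Q : ∀ x y → Q (x ⇒ y)
      ⇒-residual : ∀ x y q → Q q → ((x · q) ≤ y) ⇔ (q ≤ (x ⇒ y))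

  record SatisfiesIdentities : Set a where
    field
      id1 : ∀ x y → e ≤ ((x ∧ y) ⇒ y)
      id2 : ∀ x y z → (x ⇒ y) ≤ ((z ∧ e) ⇒ (x ⇒ y))
      id3 : ∀ x y → (x · (x ⇒ y)) ≤ y
      id4 : ∀ x y z → (z ⇒ (x ∧ y)) ≡ ((z ⇒ x) ∧ (z ⇒ y))
      id5 : ∀ x y → (e ⇒ ((e ⇒ x) · (e ⇒ y))) ≡ ((e ⇒ x) · (e ⇒ y))
      id6 : ∀ x y → (e ⇒ y) ≤ (x ⇒ (x · (e ⇒ y)))

-- For an srl-monoid each identity is a routine consequence of residuation
-- against the subalgebra Q, together with the fact that e ⇒ q = q on Q.
-- Conversely, the identities make x ↦ e ⇒ x an interior operator whose fixed
-- points form a subalgebra Q containing every x ⇒ y (identities 1, 2, 4, 5),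
-- and identities 3 and 6 are the two halves of residuation against this Q.
module Submission where

open import Defs
open import Level using (Level)
open import Data.Product using (_×_; _,_)
open import Function.Bundles using (_⇔_; mk⇔; Equivalence)
open import Relation.Binary.PropositionalEquality
open import Algebra.Structures using (IsCommutativeMonoid)
open import Algebra.Lattice.Structures using (IsLattice)
open import Algebra.Lattice.Bundles using (Lattice)
import Algebra.Lattice.Properties.Lattice as LatticeProperties
import Relation.Binary.Lattice as OrderTheoretic

module _ {a : Level} (A : Algebra22220 a) where
  open Algebra22220 A

  module LatticeOrder (isLattice : IsLattice _≡_ _∨_ _∧_) where
    private
      lattice : Lattice a a
      lattice = record { isLattice = isLattice }
      -- The library orders a lattice by x ≡ x ∧ y, the symmetric form of _≤_.
      module N = OrderTheoretic.Lattice
        (LatticeProperties.∨-∧-orderTheoreticLattice lattice)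

    open LatticeProperties lattice public using (∧-idem)

    ≤-refl : ∀ {x} → x ≤ x
    ≤-refl = sym N.refl

    ≤-trans : ∀ {x y z} → x ≤ y → y ≤ z → x ≤ z
    ≤-trans p q = sym (N.trans (sym p) (sym q))

    ≤-antisym : ∀ {x y} → x ≤ y → y ≤ x → x ≡ y
    ≤-antisym p q = N.antisym (sym p) (sym q)

    x∧y≤x : ∀ x y → (x ∧ y) ≤ x
    x∧y≤x x y = sym (N.x∧y≤x x y)

    x∧y≤y : ∀ x y → (x ∧ y) ≤ y
    x∧y≤y x y = sym (N.x∧y≤y x y)

    ∧-greatest : ∀ {x y z} → x ≤ y → x ≤ z → x ≤ (y ∧ z)
    ∧-greatest p q = sym (N.∧-greatest (sym p) (sym q))

    x≤x∨y : ∀ x y → x ≤ (x ∨ y)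
    x≤x∨y x y = sym (N.x≤x∨y x y)

    y≤x∨y : ∀ x y → y ≤ (x ∨ y)
    y≤x∨y x y = sym (N.y≤x∨y x y)

    ∨-least : ∀ {x y z} → x ≤ z → y ≤ z → (x ∨ y) ≤ z
    ∨-least p q = sym (N.∨-least (sym p) (sym q))

    ≤⇒∨≡ : ∀ {x y} → x ≤ y → x ∨ y ≡ y
    ≤⇒∨≡ {x} {y} p = ≤-antisym (∨-least p ≤-refl) (y≤x∨y x y)

  module CommLMonoidProperties (CL : IsCommLMonoid) where
    open IsCommLMonoid CL
    open IsCommutativeMonoid isCommutativeMonoid using (comm; identityˡ; identityʳ) public
    open LatticeOrder isLattice public

    ·-monoˡ-≤ : ∀ {x y} c → x ≤ y → (x · c) ≤ (y · c)
    ·-monoˡ-≤ {x} {y} c x≤y = subst ((x · c) ≤_) x·c∨y·c≡y·c (x≤x∨y (x · c) (y · c))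
      where
      x·c∨y·c≡y·c : (x · c ∨ y · c) ≡ y · c
      x·c∨y·c≡y·c = trans (sym (·-distribʳ-∨ c x y)) (cong (_· c) (≤⇒∨≡ x≤y))

    ·-monoʳ-≤ : ∀ {x y} c → x ≤ y → (c · x) ≤ (c · y)
    ·-monoʳ-≤ {x} {y} c x≤y = subst₂ _≤_ (comm x c) (comm y c) (·-monoˡ-≤ c x≤y)

  module SrlMonoidProperties (S : IsSrlMonoid) where
    open IsSrlMonoid S
    open IsSubalgebra isSubalgebra
    open CommLMonoidProperties isCommLMonoid

    residual-intro : ∀ {x y q} → Q q → (x · q) ≤ y → q ≤ (x ⇒ y)
    residual-intro {x} {y} {q} q∈Q = Equivalence.to (⇒-residual x y q q∈Q)

    residual-elim : ∀ {x y q} → Q q → q ≤ (x ⇒ y) → (x · q) ≤ y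
    residual-elim {x} {y} {q} q∈Q = Equivalence.from (⇒-residual x y q q∈Q)

    x·[x⇒y]≤y : ∀ x y → (x · (x ⇒ y)) ≤ y
    x·[x⇒y]≤y x y = residual-elim (⇒-in-Q x y) ≤-refl

    e⇒x≤x : ∀ x → (e ⇒ x) ≤ x
    e⇒x≤x x = subst (_≤ x) (identityˡ (e ⇒ x)) (x·[x⇒y]≤y e x)

    e⇒-fixes-Q : ∀ {q} → Q q → e ⇒ q ≡ q
    e⇒-fixes-Q {q} q∈Q =
      ≤-antisym (e⇒x≤x q) (residual-intro q∈Q (subst (_≤ q) (sym (identityˡ q)) ≤-refl))

    ⇒-distribˡ-∧ : ∀ x y z → z ⇒ (x ∧ y) ≡ (z ⇒ x) ∧ (z ⇒ y)
    ⇒-distribˡ-∧ x y z = ≤-antisym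
      (∧-greatest (residual-intro (⇒-in-Q z _) (≤-trans (x·[x⇒y]≤y z _) (x∧y≤x x y)))
                  (residual-intro (⇒-in-Q z _) (≤-trans (x·[x⇒y]≤y z _) (x∧y≤y x y))))
      (residual-intro (∧-closed (⇒-in-Q z x) (⇒-in-Q z y))
        (∧-greatest (≤-trans (·-monoʳ-≤ z (x∧y≤x _ _)) (x·[x⇒y]≤y z x))
                    (≤-trans (·-monoʳ-≤ z (x∧y≤y _ _)) (x·[x⇒y]≤y z y))))

    satisfiesIdentities : SatisfiesIdentities
    satisfiesIdentities = record
      { id1 = λ x y → residual-intro e-closed
                        (subst (_≤ y) (sym (identityʳ (x ∧ y))) (x∧y≤y x y))
      ; id2 = λ x y z → residual-intro (⇒-in-Q x y)
                          (subst (((z ∧ e) · (x ⇒ y)) ≤_) (identityˡ (x ⇒ y))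
                                 (·-monoˡ-≤ (x ⇒ y) (x∧y≤y z e)))
      ; id3 = x·[x⇒y]≤y
      ; id4 = ⇒-distribˡ-∧
      ; id5 = λ x y → e⇒-fixes-Q (·-closed (⇒-in-Q e x) (⇒-in-Q e y))
      ; id6 = λ x y → residual-intro (⇒-in-Q e y) ≤-refl
      }

  module FromIdentities (CL : IsCommLMonoid) (I : SatisfiesIdentities) where
    open CommLMonoidProperties CL
    open SatisfiesIdentities I

    Open : Carrier → Set a
    Open x = e ⇒ x ≡ x

    ⇒-monoʳ-≤ : ∀ {x y} z → x ≤ y → (z ⇒ x) ≤ (z ⇒ y)
    ⇒-monoʳ-≤ {x} {y} z x≤y = trans (sym (id4 x y z)) (cong (z ⇒_) x≤y)

    e⇒x≤x : ∀ x → (e ⇒ x) ≤ x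
    e⇒x≤x x = subst (_≤ x) (identityˡ (e ⇒ x)) (id3 e x)

    ≤e⇒-Open : ∀ {x} → x ≤ (e ⇒ x) → Open x
    ≤e⇒-Open {x} = ≤-antisym (e⇒x≤x x)

    ⇒-Open : ∀ x y → Open (x ⇒ y)
    ⇒-Open x y = ≤e⇒-Open (subst (λ t → (x ⇒ y) ≤ (t ⇒ (x ⇒ y))) (∧-idem e) (id2 x y e))

    isSubalgebra : IsSubalgebra Open
    isSubalgebra = record
      { ∧-closed = λ {x} {y} ox oy → trans (id4 x y e) (cong₂ _∧_ ox oy)
      ; ∨-closed = λ {x} {y} ox oy → ≤e⇒-Open
          (∨-least (subst (_≤ (e ⇒ (x ∨ y))) ox (⇒-monoʳ-≤ e (x≤x∨y x y)))
                   (subst (_≤ (e ⇒ (x ∨ y))) oy (⇒-monoʳ-≤ e (y≤x∨y x y))))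
      ; ·-closed = λ {x} {y} ox oy → subst Open (cong₂ _·_ ox oy) (id5 x y)
      ; e-closed = ≤e⇒-Open (subst (λ t → e ≤ (t ⇒ e)) (∧-idem e) (id1 e e))
      }

    ⇒-residual : ∀ x y q → Open q → ((x · q) ≤ y) ⇔ (q ≤ (x ⇒ y))
    ⇒-residual x y q q∘ = mk⇔
      (λ x·q≤y → ≤-trans (subst (λ t → t ≤ (x ⇒ (x · t))) q∘ (id6 x q)) (⇒-monoʳ-≤ x x·q≤y))
      (λ q≤x⇒y → ≤-trans (·-monoʳ-≤ x q≤x⇒y) (id3 x y))

    isSrlMonoid : IsSrlMonoid
    isSrlMonoid = record
      { isCommLMonoid = CL
      ; Q = Open
      ; isSubalgebra = isSubalgebra
      ; ⇒-in-Q = ⇒-Open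
      ; ⇒-residual = ⇒-residual
      }

theorem2p5 : ∀ {a : Level} (A : Algebra22220 a) →
    Algebra22220.IsSrlMonoid A ⇔ (Algebra22220.IsCommLMonoid A × Algebra22220.SatisfiesIdentities A)
theorem2p5 A = mk⇔
  (λ S → IsSrlMonoid.isCommLMonoid S , SrlMonoidProperties.satisfiesIdentities A S)
  (λ (CL , I) → FromIdentities.isSrlMonoid A CL I)
  where open Algebra22220 A using (IsSrlMonoid)
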